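{- Let $k,n$ be positive integers and $\mathcal{B}\subseteq\{1,\dots,k\}$ with $|\mathcal{B}|=n$. Let $\lambda=(\lambda_1,\dots,\lambda_m)$ be a composition of $n$ and $T\in\mathrm{PSTab}_{\mathcal{B}}(\lambda)$. Then the number of standard words $\sigma$ over $\mathcal{B}$ with $\mathrm{P}(\sigma)=T$ is at most $$\frac{(n-1)!}{\prod_{i=1}^{m-1}\Big(n-\sum_{j=1}^{i}\lambda_j\Big)\cdot\prod_{k'=1}^{m}(\lambda_{k'}-1)!}.$$
   Context: A standard word over a finite set $\mathcal{B}$ of integers is a word in which each element of $\mathcal{B}$ occurs exactly once. For a composition $\lambda=(\lambda_1,\dots,\lambda_m)$ of $n$ (positive integers summing to $n$), the composition diagram of shape $\lambda$ has $m$ bottom-justified columns, left to right, with $\lambda_i$ boxes in column $i$; $\mathrm{PSTab}_{\mathcal{B}}(\lambda)$ is the set of fillings of this diagram in which every element of $\mathcal{B}$ appears exactly once, every column increases from bottom to top and the bottom row (lowest boxes) increases from left to right. Patience Sorting insertion: for a word $\sigma=\sigma_1\cdots\sigma_n$ with distinct letters, $\mathrm{P}(\sigma)$ is built starting from the empty tableau; at step $j$, with $r_1<\dots<r_s$ the bottom row of the current tableau, if the tableau is empty or $r_s<\sigma_j$, a new rightmost column consisting of one box containing $\sigma_j$ is added; otherwise, with $t$ the least index such that $\sigma_j<r_t$, all entries of column $t$ are moved up one box and $\sigma_j$ is placed in the bottom box of column $t$. Empty products equal $1$. -}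

module Defs where

open import Data.Nat using (ℕ; zero; suc; _+_; _*_; _∸_; _≤_; _<_; _<ᵇ_; _!)
open import Data.Nat.ListAction using (sum; product)
open import Relation.Binary.PropositionalEquality using (_≡_)
open import Data.Bool using (if_then_else_)
open import Data.List using (List; []; _∷_; map; foldl; take; length; upTo; concat; mapMaybe; head)
open import Data.List.Relation.Unary.All using (All)
open import Data.List.Relation.Unary.Any using (Any)
open import Data.List.Relation.Unary.Linked using (Linked)
open import Data.List.Relation.Unary.Unique.Propositional using (Unique)
open import Data.List.Relation.Binary.Permutation.Propositional using (_↭_)
open import Data.Product using (_×_)

-- A tableau (filling of a composition diagram) is a list of columns, left to
-- right; each column is listed from bottom to top.
Tableau : Set
Tableau = List (List ℕ)

shape : Tableau → List ℕ
shape T = map length T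

bottomRow : Tableau → List ℕ
bottomRow T = mapMaybe head T

insertPS : Tableau → ℕ → Tableau
insertPS [] x = (x ∷ []) ∷ []
insertPS ([] ∷ cs) x = [] ∷ insertPS cs x
insertPS ((r ∷ c) ∷ cs) x =
  if x <ᵇ r then (x ∷ r ∷ c) ∷ cs else (r ∷ c) ∷ insertPS cs x

P : List ℕ → Tableau
P σ = foldl insertPS [] σ

IsComposition : ℕ → List ℕ → Set
IsComposition n λs = All (λ l → 0 < l) λs × sum λs ≡ n

IsSubsetOfSize : ℕ → ℕ → List ℕ → Set
IsSubsetOfSize k n B = Unique B × All (λ b → 1 ≤ b × b ≤ k) B × length B ≡ n

StandardWord : List ℕ → List ℕ → Set
StandardWord B σ = σ ↭ B

PSTab : List ℕ → List ℕ → Tableau → Set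
PSTab B λs T =
  shape T ≡ λs ×
  concat T ↭ B ×
  All (Linked _<_) T ×
  Linked _<_ (bottomRow T)

-- ∏_{i=1}^{m-1} (n - Σ_{j=1}^{i} λ_j)
prodTails : ℕ → List ℕ → ℕ
prodTails n λs = product (map (λ i → n ∸ sum (take (suc i) λs)) (upTo (length λs ∸ 1)))

prodFacts : List ℕ → ℕ
prodFacts λs = product (map (λ l → (l ∸ 1) !) λs)

-- Read a word from the right: σ = ρ x gives P σ = insertPS (P ρ) x, so x sits at
-- the bottom of a column of P σ and removing it gives back P ρ. Hence the words
-- with P-tableau T are at most the sum, over the possible removals T ↦ T′, of the
-- words with P-tableau T′, and by induction at most
-- fibreBound λ = ∏ᵢ C(λᵢ − 1 + λᵢ₊₁ + ⋯ + λₘ, λᵢ − 1) for λ the shape of T, since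
-- fibreBound satisfies that recursion by Pascal's rule. Multiplied by the
-- denominator of the claimed bound, fibreBound λ telescopes to (n − 1)!.

module Submission where

open import Defs
open import Data.Nat using (ℕ; zero; suc; _+_; _*_; _∸_; _≤_; _<_; _<ᵇ_; _!; z≤n; s≤s; _≟_)
open import Data.Nat.Properties
open import Data.Nat.Combinatorics using (_C_; nCk≡n!/k![n-k]!; k![n∸k]!∣n!; nCk+nC[k+1]≡[n+1]C[k+1]; nCn≡1)
open import Data.Nat.DivMod using (m/n*n≡m)
open import Data.Nat.ListAction using (sum; product)
open import Data.Nat.Solver using (module +-*-Solver)
open import Data.Bool using (true; false)
open import Data.List using (List; []; _∷_; _++_; length; map; foldr; filter; take; upTo; applyUpTo; reverse)
open import Data.List.Properties using (map-applyUpTo; map-upTo; map-cong; map-∘; reverse-foldl; reverse-involutive; reverse-injective; length-map; ≡-dec; filter-accept)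
open import Data.List.Membership.Propositional using (_∈_)
open import Data.List.Membership.Propositional.Properties using (∈-map⁺; ∈-++⁺ʳ)
open import Data.List.Relation.Unary.All using (All; []; _∷_)
import Data.List.Relation.Unary.All as All
import Data.List.Relation.Unary.All.Properties as All
open import Data.List.Relation.Unary.Any using (Any; here; there)
import Data.List.Relation.Unary.Any as Any
open import Data.List.Relation.Unary.AllPairs using ([]; _∷_)
open import Data.List.Relation.Unary.Unique.Propositional using (Unique)
import Data.List.Relation.Unary.Unique.Propositional.Properties as Unique
open import Data.Product using (_×_; _,_; proj₂; map₂)
open import Data.Empty using (⊥)
open import Function using (_∘_; flip)
open import Relation.Nullary using (yes; no; does; contradiction)
open import Relation.Binary.Definitions using (DecidableEquality)
open import Relation.Binary.PropositionalEquality using (_≡_; _≢_; refl; sym; trans; cong; cong₂; subst; module ≡-Reasoning)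

binom : ℕ → ℕ → ℕ
binom a b = (a + b) C a

C*k!*[n∸k]!≡n! : ∀ {n k} → k ≤ n → (n C k) * (k ! * (n ∸ k) !) ≡ n !
C*k!*[n∸k]!≡n! {n} {k} k≤n =
  trans (cong (_* (k ! * (n ∸ k) !)) (nCk≡n!/k![n-k]! k≤n)) (m/n*n≡m (k![n∸k]!∣n! k≤n))
  where instance _ = k !* (n ∸ k) !≢0

binom*a!*b!≡[a+b]! : ∀ a b → binom a b * (a ! * b !) ≡ (a + b) !
binom*a!*b!≡[a+b]! a b =
  subst (λ m → binom a b * (a ! * m !) ≡ (a + b) !) (m+n∸m≡n a b) (C*k!*[n∸k]!≡n! (m≤m+n a b))

binom-pascal : ∀ a b → binom (suc a) (suc b) ≡ binom a (suc b) + binom (suc a) b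
binom-pascal a b = begin
  binom (suc a) (suc b)                     ≡⟨ nCk+nC[k+1]≡[n+1]C[k+1] (a + suc b) a ⟨
  binom a (suc b) + (a + suc b) C suc a     ≡⟨ cong (λ m → binom a (suc b) + m C suc a) (+-suc a b) ⟩
  binom a (suc b) + binom (suc a) b         ∎
  where open ≡-Reasoning

binom-zeroʳ : ∀ a → binom a 0 ≡ 1
binom-zeroʳ a = trans (cong (_C a) (+-identityʳ a)) (nCn≡1 a)

fibreBound : List ℕ → ℕ
fibreBound []      = 1
fibreBound (l ∷ ρ) = binom (l ∸ 1) (sum ρ) * fibreBound ρ

prodTails-∷-∷ : ∀ m a b ρ → prodTails (a + m) (a ∷ b ∷ ρ) ≡ m * prodTails m (b ∷ ρ)
prodTails-∷-∷ m a b ρ = cong₂ _*_ first-factor (cong product (begin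
  map factor (applyUpTo suc (length ρ))   ≡⟨ map-applyUpTo suc factor (length ρ) ⟩
  applyUpTo (factor ∘ suc) (length ρ)     ≡⟨ map-upTo (factor ∘ suc) (length ρ) ⟨
  map (factor ∘ suc) (upTo (length ρ))
    ≡⟨ map-cong (λ i → [m+n]∸[m+o]≡n∸o a m (sum (take (suc i) (b ∷ ρ)))) (upTo (length ρ)) ⟩
  map factor′ (upTo (length ρ))           ∎))
  where
  open ≡-Reasoning
  factor factor′ : ℕ → ℕ
  factor i  = (a + m) ∸ sum (take (suc i) (a ∷ b ∷ ρ))
  factor′ i = m ∸ sum (take (suc i) (b ∷ ρ))
  first-factor : (a + m) ∸ (a + 0) ≡ m
  first-factor = trans (cong (a + m ∸_) (+-identityʳ a)) (m+n∸m≡n a m)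

fibreBound-*-denominator : ∀ λs → All (0 <_) λs →
  fibreBound λs * (prodTails (sum λs) λs * prodFacts λs) ≡ (sum λs ∸ 1) !
fibreBound-*-denominator [] _ = refl
fibreBound-*-denominator (zero ∷ _) (() ∷ _)
fibreBound-*-denominator (suc a ∷ zero ∷ _) (_ ∷ () ∷ _)
fibreBound-*-denominator (suc a ∷ []) _ = begin
  binom a 0 * 1 * (1 * (a ! * 1))
    ≡⟨ solve 2 (λ x y → x :* con 1 :* (con 1 :* (y :* con 1)) := x :* (y :* con 1)) refl (binom a 0) (a !) ⟩
  binom a 0 * (a ! * 0 !)
    ≡⟨ binom*a!*b!≡[a+b]! a 0 ⟩
  (a + 0) !
    ∎
  where open ≡-Reasoning; open +-*-Solver
fibreBound-*-denominator (suc a ∷ suc b ∷ ρ) (_ ∷ positive) = begin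
  binom a S * F * (prodTails (suc a + S) (suc a ∷ ρ′) * (a ! * R))
    ≡⟨ cong (λ t → binom a S * F * (t * (a ! * R))) (prodTails-∷-∷ S (suc a) (suc b) ρ) ⟩
  binom a S * F * (S * prodTails S ρ′ * (a ! * R))
    ≡⟨ solve 6 (λ c f s t x r → c :* f :* (s :* t :* (x :* r)) := c :* (x :* (s :* (f :* (t :* r)))))
         refl (binom a S) F S (prodTails S ρ′) (a !) R ⟩
  binom a S * (a ! * (S * (F * (prodTails S ρ′ * R))))
    ≡⟨ cong (λ t → binom a S * (a ! * (S * t))) (fibreBound-*-denominator ρ′ positive) ⟩
  binom a S * (a ! * S !)
    ≡⟨ binom*a!*b!≡[a+b]! a S ⟩
  (a + S) !
    ∎
  where
  open ≡-Reasoning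
  open +-*-Solver
  ρ′ = suc b ∷ ρ
  S  = sum ρ′
  F  = fibreBound ρ′
  R  = prodFacts ρ′

sum-map-mono : ∀ {A : Set} {f g : A → ℕ} {xs : List A} →
  All (λ x → f x ≤ g x) xs → sum (map f xs) ≤ sum (map g xs)
sum-map-mono []         = ≤-refl
sum-map-mono (le ∷ les) = +-mono-≤ le (sum-map-mono les)

sum-map-mono-< : ∀ {A : Set} {f g : A → ℕ} {xs : List A} → (∀ x → f x ≤ g x) →
  Any (λ x → f x < g x) xs → sum (map f xs) < sum (map g xs)
sum-map-mono-< {xs = x ∷ xs} f≤g (here lt)  = +-mono-<-≤ lt (sum-map-mono {xs = xs} (All.tabulate (λ {y} _ → f≤g y)))
sum-map-mono-< {xs = x ∷ xs} f≤g (there lt) = +-mono-≤-< (f≤g x) (sum-map-mono-< f≤g lt)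

unique-constant-length≤1 : ∀ {A : Set} {w : A} {ws : List A} → Unique ws → All (_≡ w) ws → length ws ≤ 1
unique-constant-length≤1 {ws = []}        _               _                 = z≤n
unique-constant-length≤1 {ws = _ ∷ []}    _               _                 = ≤-refl
unique-constant-length≤1 {ws = _ ∷ _ ∷ _} ((x≢y ∷ _) ∷ _) (refl ∷ refl ∷ _) = contradiction refl x≢y

module Fibres {A B : Set} (_≟ᴬ_ : DecidableEquality A) (_≟ᴮ_ : DecidableEquality B) (g : List A → B) where

  tailsFrom : A → List (List A) → List (List A)
  tailsFrom x []             = []
  tailsFrom x ([] ∷ ws)      = tailsFrom x ws
  tailsFrom x ((y ∷ ρ) ∷ ws) with y ≟ᴬ x
  ... | yes _ = ρ ∷ tailsFrom x ws
  ... | no  _ = tailsFrom x ws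

  tailsFrom-All : ∀ {P : List A → Set} x {ws} → All P ws → All (λ ρ → P (x ∷ ρ)) (tailsFrom x ws)
  tailsFrom-All x {[]}           []         = []
  tailsFrom-All x {[] ∷ ws}      (_ ∷ pws)  = tailsFrom-All x pws
  tailsFrom-All x {(y ∷ ρ) ∷ ws} (p ∷ pws) with y ≟ᴬ x
  ... | yes refl = p ∷ tailsFrom-All x pws
  ... | no  _    = tailsFrom-All x pws

  tailsFrom-unique : ∀ x {ws} → Unique ws → Unique (tailsFrom x ws)
  tailsFrom-unique x {[]}           []          = []
  tailsFrom-unique x {[] ∷ ws}      (_ ∷ u)     = tailsFrom-unique x u
  tailsFrom-unique x {(y ∷ ρ) ∷ ws} (fresh ∷ u) with y ≟ᴬ x
  ... | yes refl =
    All.map (λ y∷ρ≢ ρ≡ → y∷ρ≢ (cong (y ∷_) ρ≡)) (tailsFrom-All y fresh) ∷ tailsFrom-unique x u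
  ... | no  _    = tailsFrom-unique x u

  fibre : A × B → List (List A) → List (List A)
  fibre (x , b) ws = filter (λ ρ → g ρ ≟ᴮ b) (tailsFrom x ws)

  fibre-unique : ∀ p {ws} → Unique ws → Unique (fibre p ws)
  fibre-unique (x , b) u = Unique.filter⁺ (λ ρ → g ρ ≟ᴮ b) (tailsFrom-unique x u)

  fibre-All : ∀ x b ws → All (λ ρ → g ρ ≡ b) (fibre (x , b) ws)
  fibre-All x b ws = All.all-filter (λ ρ → g ρ ≟ᴮ b) (tailsFrom x ws)

  fibre-∷-≤ : ∀ p w ws → length (fibre p ws) ≤ length (fibre p (w ∷ ws))
  fibre-∷-≤ p       []      ws = ≤-refl
  fibre-∷-≤ (x , b) (y ∷ ρ) ws with y ≟ᴬ x
  ... | no  _ = ≤-refl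
  ... | yes _ with does (g ρ ≟ᴮ b)
  ...   | true  = n≤1+n _
  ...   | false = ≤-refl

  fibre-∷-< : ∀ x ρ ws → length (fibre (x , g ρ) ws) < length (fibre (x , g ρ) ((x ∷ ρ) ∷ ws))
  fibre-∷-< x ρ ws with x ≟ᴬ x
  ... | no  x≢x = contradiction refl x≢x
  ... | yes _   = ≤-reflexive (cong length (sym (filter-accept (λ σ → g σ ≟ᴮ g ρ) refl)))

  KeyIn : List (A × B) → List A → Set
  KeyIn ps []      = ⊥
  KeyIn ps (x ∷ ρ) = (x , g ρ) ∈ ps

  length≤sum-fibres : ∀ ps {ws} → All (KeyIn ps) ws → length ws ≤ sum (map (λ p → length (fibre p ws)) ps)
  length≤sum-fibres ps {[]}           []           = z≤n
  length≤sum-fibres ps {(x ∷ ρ) ∷ ws} (x∈ps ∷ keys) = ≤-trans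
    (s≤s (length≤sum-fibres ps keys))
    (sum-map-mono-< (λ p → fibre-∷-≤ p (x ∷ ρ) ws) (Any.map (λ { refl → fibre-∷-< x ρ ws }) x∈ps))

Pʳ : List ℕ → Tableau
Pʳ = foldr (flip insertPS) []

P≡Pʳ∘reverse : ∀ σ → P σ ≡ Pʳ (reverse σ)
P≡Pʳ∘reverse σ = trans (cong P (sym (reverse-involutive σ))) (reverse-foldl insertPS [] (reverse σ))

insertPS≢[] : ∀ T x → insertPS T x ≢ []
insertPS≢[] []             x ()
insertPS≢[] ([] ∷ cs)      x ()
insertPS≢[] ((r ∷ c) ∷ cs) x with x <ᵇ r
... | true  = λ ()
... | false = λ ()

Pʳ≡[]⇒≡[] : ∀ ρ → Pʳ ρ ≡ [] → ρ ≡ []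
Pʳ≡[]⇒≡[] []      _  = refl
Pʳ≡[]⇒≡[] (x ∷ ρ) eq = contradiction eq (insertPS≢[] (Pʳ ρ) x)

size : Tableau → ℕ
size T = sum (shape T)

NoEmptyColumn : Tableau → Set
NoEmptyColumn = All ((0 <_) ∘ length)

-- A letter x with insertPS T′ x ≡ T sits at the bottom of a column of T, and it
-- created that column only if the column is the last one.
bottomRemovals : List ℕ → Tableau → List (ℕ × Tableau)
bottomRemovals []          _       = []
bottomRemovals (x ∷ [])    []      = (x , []) ∷ []
bottomRemovals (x ∷ [])    (_ ∷ _) = []
bottomRemovals (x ∷ r ∷ c) cs      = (x , (r ∷ c) ∷ cs) ∷ []

removals : Tableau → List (ℕ × Tableau)
removals []       = []
removals (c ∷ cs) = bottomRemovals c cs ++ map (map₂ (c ∷_)) (removals cs)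

∈-removals-insertPS : ∀ T x → (x , T) ∈ removals (insertPS T x)
∈-removals-insertPS []             x = here refl
∈-removals-insertPS ([] ∷ cs)      x = ∈-map⁺ (map₂ ([] ∷_)) (∈-removals-insertPS cs x)
∈-removals-insertPS ((r ∷ c) ∷ cs) x with x <ᵇ r
... | true  = here refl
... | false = ∈-++⁺ʳ (bottomRemovals (r ∷ c) (insertPS cs x))
                     (∈-map⁺ (map₂ ((r ∷ c) ∷_)) (∈-removals-insertPS cs x))

removals-size : ∀ T → All (λ q → suc (size (proj₂ q)) ≡ size T) (removals T)
removals-size []       = []
removals-size (c ∷ cs) = All.++⁺ (bottom c cs)
  (All.map⁺ (All.map (λ eq → trans (sym (+-suc (length c) _)) (cong (length c +_) eq)) (removals-size cs)))
  where
  bottom : ∀ c cs → All (λ q → suc (size (proj₂ q)) ≡ size (c ∷ cs)) (bottomRemovals c cs)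
  bottom []          _       = []
  bottom (x ∷ [])    []      = refl ∷ []
  bottom (x ∷ [])    (_ ∷ _) = []
  bottom (x ∷ r ∷ c) cs      = refl ∷ []

removals-noEmptyColumn : ∀ {T} → NoEmptyColumn T → All (NoEmptyColumn ∘ proj₂) (removals T)
removals-noEmptyColumn {[]}     []         = []
removals-noEmptyColumn {c ∷ cs} (nc ∷ ncs) =
  All.++⁺ (bottom c ncs) (All.map⁺ (All.map (nc ∷_) (removals-noEmptyColumn ncs)))
  where
  bottom : ∀ c {cs} → NoEmptyColumn cs → All (NoEmptyColumn ∘ proj₂) (bottomRemovals c cs)
  bottom []                  _   = []
  bottom (x ∷ [])    {[]}    _   = [] ∷ []
  bottom (x ∷ [])    {_ ∷ _} _   = []
  bottom (x ∷ r ∷ c)         ncs = (s≤s z≤n ∷ ncs) ∷ []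

sum-map-*-const : ∀ {A : Set} {f g : A → ℕ} {k : ℕ} {xs : List A} →
  All (λ x → f x ≡ k) xs → sum (map (λ x → f x * g x) xs) ≡ k * sum (map g xs)
sum-map-*-const {k = k} []         = sym (*-zeroʳ k)
sum-map-*-const {f = f} {g} {k} {x ∷ xs} (eq ∷ eqs) = begin
  f x * g x + sum (map (λ y → f y * g y) xs)  ≡⟨ cong₂ (λ a b → a * g x + b) eq (sum-map-*-const eqs) ⟩
  k * g x + k * sum (map g xs)                ≡⟨ *-distribˡ-+ k (g x) (sum (map g xs)) ⟨
  k * sum (map g (x ∷ xs))                    ∎
  where open ≡-Reasoning

weight : ℕ × Tableau → ℕ
weight = fibreBound ∘ shape ∘ proj₂

sum-weight-extend : ∀ c {s} qs → All (λ q → size (proj₂ q) ≡ s) qs →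
  sum (map weight (map (map₂ (c ∷_)) qs)) ≡ binom (length c ∸ 1) s * sum (map weight qs)
sum-weight-extend c qs sizes =
  trans (cong sum (sym (map-∘ qs))) (sum-map-*-const (All.map (cong (binom (length c ∸ 1))) sizes))

sum-weight-removals≤fibreBound : ∀ T → NoEmptyColumn T → sum (map weight (removals T)) ≤ fibreBound (shape T)
sum-weight-removals≤fibreBound [] _ = z≤n
sum-weight-removals≤fibreBound ([] ∷ _) (() ∷ _)
sum-weight-removals≤fibreBound ((x ∷ []) ∷ []) _ = ≤-refl
sum-weight-removals≤fibreBound ((x ∷ []) ∷ [] ∷ _) (_ ∷ () ∷ _)
sum-weight-removals≤fibreBound ((x ∷ []) ∷ (y ∷ c) ∷ cs) (_ ∷ ne) = begin
  sum (map weight (map (map₂ ((x ∷ []) ∷_)) rs))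
    ≡⟨ sum-weight-extend (x ∷ []) rs (All.map suc-injective (removals-size T)) ⟩
  binom 0 (length c + size cs) * sum (map weight rs)
    ≤⟨ *-monoʳ-≤ (binom 0 (length c + size cs)) (sum-weight-removals≤fibreBound T ne) ⟩
  binom 0 (length c + size cs) * fibreBound (shape T)
    ≡⟨⟩
  1 * fibreBound (shape T)
    ∎
  where
  open ≤-Reasoning
  T  = (y ∷ c) ∷ cs
  rs = removals T
sum-weight-removals≤fibreBound ((x ∷ r ∷ c) ∷ []) _
  rewrite binom-zeroʳ (length c) | binom-zeroʳ (suc (length c)) = ≤-refl
sum-weight-removals≤fibreBound ((x ∷ r ∷ c) ∷ [] ∷ _) (_ ∷ () ∷ _)
sum-weight-removals≤fibreBound ((x ∷ r ∷ c) ∷ (y ∷ c′) ∷ cs) (_ ∷ ne) = begin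
  binom k (suc s) * F + sum (map weight (map (map₂ ((x ∷ r ∷ c) ∷_)) rs))
    ≡⟨ cong (binom k (suc s) * F +_) (sum-weight-extend (x ∷ r ∷ c) rs (All.map suc-injective (removals-size T))) ⟩
  binom k (suc s) * F + binom (suc k) s * sum (map weight rs)
    ≤⟨ +-monoʳ-≤ (binom k (suc s) * F) (*-monoʳ-≤ (binom (suc k) s) (sum-weight-removals≤fibreBound T ne)) ⟩
  binom k (suc s) * F + binom (suc k) s * F
    ≡⟨ *-distribʳ-+ F (binom k (suc s)) (binom (suc k) s) ⟨
  (binom k (suc s) + binom (suc k) s) * F
    ≡⟨ cong (_* F) (binom-pascal k s) ⟨
  binom (suc k) (suc s) * F
    ∎
  where
  open ≤-Reasoning
  T  = (y ∷ c′) ∷ cs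
  rs = removals T
  k  = length c
  s  = length c′ + size cs
  F  = fibreBound (shape T)

open Fibres _≟_ (≡-dec (≡-dec _≟_)) Pʳ

length≤fibreBound : ∀ N T {ws} → size T ≡ N → NoEmptyColumn T → Unique ws →
  All (λ ρ → Pʳ ρ ≡ T) ws → length ws ≤ fibreBound (shape T)
length≤fibreBound zero    []            _  _        u eqs = unique-constant-length≤1 u (All.map (Pʳ≡[]⇒≡[] _) eqs)
length≤fibreBound zero    ((_ ∷ _) ∷ _) () _        _ _
length≤fibreBound zero    ([] ∷ _)      _  (() ∷ _) _ _
length≤fibreBound (suc N) T {ws} sizeT ne u eqs = begin
  length ws
    ≤⟨ length≤sum-fibres (removals T) (All.map keyIn eqs) ⟩
  sum (map (λ q → length (fibre q ws)) (removals T))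
    ≤⟨ sum-map-mono (All.zipWith fibre≤weight (removals-size T , removals-noEmptyColumn ne)) ⟩
  sum (map weight (removals T))
    ≤⟨ sum-weight-removals≤fibreBound T ne ⟩
  fibreBound (shape T)
    ∎
  where
  open ≤-Reasoning
  keyIn : ∀ {ρ} → Pʳ ρ ≡ T → KeyIn (removals T) ρ
  keyIn {[]}    eq = contradiction (trans (cong size eq) sizeT) 0≢1+n
  keyIn {x ∷ ρ} eq = subst (λ t → (x , Pʳ ρ) ∈ removals t) eq (∈-removals-insertPS (Pʳ ρ) x)
  fibre≤weight : ∀ {q} → suc (size (proj₂ q)) ≡ size T × NoEmptyColumn (proj₂ q) → length (fibre q ws) ≤ weight q
  fibre≤weight {x , T′} (eq , ne′) =
    length≤fibreBound N T′ (suc-injective (trans eq sizeT)) ne′ (fibre-unique (x , T′) u) (fibre-All x T′ ws)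

proposition5p6 : (k n : ℕ) → 0 < k → 0 < n →
    (B : List ℕ) → IsSubsetOfSize k n B →
    (λs : List ℕ) → IsComposition n λs →
    (T : Tableau) → PSTab B λs T →
    (ws : List (List ℕ)) → Unique ws →
    All (λ σ → StandardWord B σ × P σ ≡ T) ws →
    length ws * (prodTails n λs * prodFacts λs) ≤ (n ∸ 1) !
proposition5p6 _ _ _ _ _ _ λs (positive , refl) T (refl , _) ws unique-ws words = begin
  length ws * D        ≤⟨ *-monoˡ-≤ D count≤fibreBound ⟩
  fibreBound λs * D    ≡⟨ fibreBound-*-denominator λs positive ⟩
  (sum λs ∸ 1) !       ∎
  where
  open ≤-Reasoning
  D = prodTails (sum λs) λs * prodFacts λs
  count≤fibreBound : length ws ≤ fibreBound λs
  count≤fibreBound = subst (_≤ fibreBound λs) (length-map reverse ws)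
    (length≤fibreBound (sum λs) T refl (All.map⁻ positive) (Unique.map⁺ reverse-injective unique-ws)
      (All.map⁺ (All.map (λ {σ} (_ , Pσ≡T) → trans (sym (P≡Pʳ∘reverse σ)) Pσ≡T) words)))
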